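{- Let $G=\langle V,E\rangle$ be a connected chordal graph and let $S,T$ be distinct vertices of $G$. There exists a non-separating path from $S$ to $T$ if and only if $S$ and $T$ are not separated by a bridge (i.e. there is no bridge $e$ such that $S$ and $T$ lie in different connected components of $G$ with $e$ removed). Moreover, when such a path exists, a path from $S$ to $T$ containing the minimum number of edges is a non-separating path.
   Context: A chordal graph is a simple undirected graph in which every cycle with four or more vertices has a chord. A bridge is an edge whose removal disconnects $G$. A path is a sequence of vertices with consecutive vertices adjacent. A path $p$ is non-separating if the graph obtained from $G$ by deleting all edges lying on $p$ is still connected. -}

module Defs where

open import Level using (0ℓ)
open import Data.Nat using (ℕ; suc; _≤_)
open import Data.Nat.DivMod using (_mod_)
open import Data.Fin using (Fin; toℕ)
open import Data.Product using (Σ; ∃; ∃-syntax; _×_; _,_)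
open import Data.Sum using (_⊎_)
open import Relation.Nullary using (¬_)
open import Relation.Binary using (Rel; Symmetric; Irreflexive; Decidable)
open import Relation.Binary.PropositionalEquality using (_≡_; _≢_)
open import Function.Definitions using (Injective)

record SimpleGraph {n : ℕ} (E : Rel (Fin n) 0ℓ) : Set where
  field
    sym     : Symmetric E
    irrefl  : Irreflexive _≡_ E
    dec     : Decidable E

module _ {n : ℕ} where

  -- A path (in the paper's sense): a sequence of vertices, consecutive ones adjacent.
  -- 'Walk E u w' is such a sequence starting at u and ending at w.
  data Walk (E : Rel (Fin n) 0ℓ) : Fin n → Fin n → Set where
    []  : ∀ {v} → Walk E v v
    _∷_ : ∀ {u v w} → E u v → Walk E v w → Walk E u w

  len : ∀ {E u w} → Walk E u w → ℕ
  len []      = 0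
  len (_ ∷ p) = suc (len p)

  SameEdge : Fin n → Fin n → Fin n → Fin n → Set
  SameEdge x y a b = (x ≡ a × y ≡ b) ⊎ (x ≡ b × y ≡ a)

  data OnWalk {E : Rel (Fin n) 0ℓ} (x y : Fin n) : ∀ {u w} → Walk E u w → Set where
    here  : ∀ {u v w} (e : E u v) (p : Walk E v w) → SameEdge x y u v → OnWalk x y (e ∷ p)
    there : ∀ {u v w} (e : E u v) (p : Walk E v w) → OnWalk x y p → OnWalk x y (e ∷ p)

  DeletePath : ∀ {E u w} → Walk E u w → Rel (Fin n) 0ℓ
  DeletePath {E} p x y = E x y × ¬ OnWalk x y p

  DeleteEdge : Rel (Fin n) 0ℓ → Fin n → Fin n → Rel (Fin n) 0ℓ
  DeleteEdge E a b x y = E x y × ¬ SameEdge x y a b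

  Connected : Rel (Fin n) 0ℓ → Set
  Connected E = ∀ x y → Walk E x y

  NonSeparating : ∀ {E u w} → Walk E u w → Set
  NonSeparating p = Connected (DeletePath p)

  IsBridge : Rel (Fin n) 0ℓ → Fin n → Fin n → Set
  IsBridge E a b = E a b × ¬ Connected (DeleteEdge E a b)

  SeparatedByBridge : Rel (Fin n) 0ℓ → Fin n → Fin n → Set
  SeparatedByBridge E S T = ∃[ a ] ∃[ b ] (IsBridge E a b × ¬ Walk (DeleteEdge E a b) S T)

  Shortest : ∀ {E S T} → Walk E S T → Set
  Shortest {E} {S} {T} p = ∀ (q : Walk E S T) → len p ≤ len q

csuc : ∀ {k} → Fin (suc k) → Fin (suc k)
csuc {k} i = suc (toℕ i) mod suc k

-- Chordal: every cycle with at least four vertices (distinct vertices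
-- c 0, …, c (m+3), with c i adjacent to c (i+1 mod m+4)) has a chord, i.e. an
-- edge between two cycle vertices that are not consecutive on the cycle.
Chordal : ∀ {n} → Rel (Fin n) 0ℓ → Set
Chordal {n} E =
  ∀ (m : ℕ) (c : Fin (suc (suc (suc (suc m)))) → Fin n) →
  Injective _≡_ _≡_ c →
  (∀ i → E (c i) (c (csuc i))) →
  ∃[ i ] ∃[ j ] (E (c i) (c j) × j ≢ csuc i × i ≢ csuc j)

module Submission where

open import Defs
open import Level using (0ℓ)
open import Data.Nat using (ℕ; zero; suc; _≤_; _<_; z≤n; s≤s; _%_)
open import Data.Nat.Properties using (≤-refl; ≤-trans; ≤-pred; m≤n⇒m≤1+n; 1+n≰n; <-cmp; m≤n⇒m<n∨m≡n)
open import Data.Nat.DivMod using (m<n⇒m%n≡m; n%n≡0)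
open import Data.Fin using (Fin; toℕ; _≟_)
open import Data.Fin.Properties using (toℕ-injective; toℕ<n; toℕ-fromℕ<; any?)
open import Data.Product using (Σ; _×_; _,_; proj₁; proj₂; ∃-syntax)
open import Data.Sum using (_⊎_; inj₁; inj₂)
open import Data.Unit using (⊤; tt)
open import Data.Empty using (⊥; ⊥-elim)
open import Relation.Nullary using (¬_; Dec; yes; no)
open import Relation.Nullary.Decidable using (_×-dec_; _⊎-dec_; ¬?; map′)
open import Relation.Binary using (Rel; Decidable; Symmetric; tri<; tri≈; tri>)
open import Relation.Binary.PropositionalEquality using (_≡_; _≢_; refl; sym; trans; cong; subst; subst₂)
open import Function.Bundles using (_⇔_; mk⇔)
open import Function.Definitions using (Injective)

-- Work with an induced S–T path p; a shortest one is induced. If every edge xy of p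
-- has a common neighbour w, then w lies off p (p is induced), and replacing each use
-- of xy by x–w–y turns any walk of G into a walk of G − p. If some edge xy of p has no
-- common neighbour, then G − xy has no x–y walk: its shortest one would close up with
-- xy into a chordless cycle of length at least 4. So xy is a bridge, and it separates
-- S from T, because the two pieces of p around xy link S and T to x and y in G − xy.
-- Conversely, a non-separating path either contains a bridge e, and then G − p ⊆ G − e
-- is connected, or it avoids e and joins S to T in G − e.

module _ {n : ℕ} where

  sameEdge? : (x y a b : Fin n) → Dec (SameEdge x y a b)
  sameEdge? x y a b = (x ≟ a ×-dec y ≟ b) ⊎-dec (x ≟ b ×-dec y ≟ a)

  sameEdge-sym : ∀ {x y a b : Fin n} → SameEdge x y a b → SameEdge a b x y
  sameEdge-sym (inj₁ (xa , yb)) = inj₁ (sym xa , sym yb)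
  sameEdge-sym (inj₂ (xb , ya)) = inj₂ (sym ya , sym xb)

  sameEdge-swap : ∀ {x y a b : Fin n} → SameEdge y x a b → SameEdge x y a b
  sameEdge-swap (inj₁ (ya , xb)) = inj₂ (xb , ya)
  sameEdge-swap (inj₂ (yb , xa)) = inj₁ (xa , yb)

  sameEdge-endpoint : ∀ {x y a b z : Fin n} → SameEdge x y a b → z ≡ a ⊎ z ≡ b → z ≡ x ⊎ z ≡ y
  sameEdge-endpoint (inj₁ (refl , refl)) za = za
  sameEdge-endpoint (inj₂ (refl , refl)) (inj₁ zy) = inj₂ zy
  sameEdge-endpoint (inj₂ (refl , refl)) (inj₂ zx) = inj₁ zx

  Walk-map : ∀ {R R′ : Rel (Fin n) 0ℓ} → (∀ {x y} → R x y → R′ x y) → ∀ {a b} → Walk R a b → Walk R′ a b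
  Walk-map f [] = []
  Walk-map f (e ∷ p) = f e ∷ Walk-map f p

  DeleteEdge-sym : ∀ {R : Rel (Fin n) 0ℓ} {x y} → Symmetric R → Symmetric (DeleteEdge R x y)
  DeleteEdge-sym R-sym (e , ≢xy) = R-sym e , λ s → ≢xy (sameEdge-swap s)

  DeleteEdge-dec : ∀ {R : Rel (Fin n) 0ℓ} {x y} → Decidable R → Decidable (DeleteEdge R x y)
  DeleteEdge-dec {x = x} {y} R? c d = R? c d ×-dec ¬? (sameEdge? c d x y)

module _ {n : ℕ} {R : Rel (Fin n) 0ℓ} where

  infix 4 _∈ᵥ_ _∉ᵥ_

  _∈ᵥ_ : ∀ {a b} → Fin n → Walk R a b → Set
  _∈ᵥ_ {a} x [] = x ≡ a
  x ∈ᵥ (_∷_ {u} _ p) = x ≡ u ⊎ x ∈ᵥ p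

  _∉ᵥ_ : ∀ {a b} → Fin n → Walk R a b → Set
  x ∉ᵥ p = ¬ x ∈ᵥ p

  start∈ᵥ : ∀ {a b} (p : Walk R a b) → a ∈ᵥ p
  start∈ᵥ [] = refl
  start∈ᵥ (e ∷ p) = inj₁ refl

  _∈ᵥ?_ : ∀ {a b} x (p : Walk R a b) → Dec (x ∈ᵥ p)
  _∈ᵥ?_ {a} x [] = x ≟ a
  x ∈ᵥ? (_∷_ {u} _ p) = x ≟ u ⊎-dec x ∈ᵥ? p

  _++_ : ∀ {a b c} → Walk R a b → Walk R b c → Walk R a c
  [] ++ q = q
  (e ∷ p) ++ q = e ∷ (p ++ q)

  reverse : Symmetric R → ∀ {a b} → Walk R a b → Walk R b a
  reverse R-sym [] = []
  reverse R-sym (e ∷ p) = reverse R-sym p ++ (R-sym e ∷ [])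

  onWalk? : ∀ x y {a b} (p : Walk R a b) → Dec (OnWalk x y p)
  onWalk? x y [] = no λ ()
  onWalk? x y (_∷_ {u} {v} e p) =
    map′ (λ { (inj₁ s) → here e p s ; (inj₂ o) → there e p o })
         (λ { (here _ _ s) → inj₁ s ; (there _ _ o) → inj₂ o })
         (sameEdge? x y u v ⊎-dec onWalk? x y p)

  onWalk⇒∈ᵥ : ∀ {x y a b} {p : Walk R a b} → OnWalk x y p → x ∈ᵥ p × y ∈ᵥ p
  onWalk⇒∈ᵥ (here e p (inj₁ (refl , refl))) = inj₁ refl , inj₂ (start∈ᵥ p)
  onWalk⇒∈ᵥ (here e p (inj₂ (refl , refl))) = inj₂ (start∈ᵥ p) , inj₁ refl
  onWalk⇒∈ᵥ (there e p o) = inj₂ (proj₁ (onWalk⇒∈ᵥ o)) , inj₂ (proj₂ (onWalk⇒∈ᵥ o))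

  onWalk⇒edge : Symmetric R → ∀ {x y a b} {p : Walk R a b} → OnWalk x y p → R x y
  onWalk⇒edge R-sym (here e p (inj₁ (refl , refl))) = e
  onWalk⇒edge R-sym (here e p (inj₂ (refl , refl))) = R-sym e
  onWalk⇒edge R-sym (there e p o) = onWalk⇒edge R-sym o

  onWalk-swap : ∀ {x y a b} {p : Walk R a b} → OnWalk x y p → OnWalk y x p
  onWalk-swap (here e p s) = here e p (sameEdge-swap s)
  onWalk-swap (there e p o) = there e p (onWalk-swap o)

  onWalk-sameEdge : ∀ {x y c d a b} {p : Walk R a b} → SameEdge c d x y → OnWalk x y p → OnWalk c d p
  onWalk-sameEdge (inj₁ (refl , refl)) on = on
  onWalk-sameEdge (inj₂ (refl , refl)) on = onWalk-swap on

  NoChordFrom : ∀ {a b} → Fin n → Walk R a b → Set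
  NoChordFrom u [] = ⊤
  NoChordFrom u (_ ∷ p) = ∀ x → x ∈ᵥ p → ¬ R u x

  Induced : ∀ {a b} → Walk R a b → Set
  Induced [] = ⊤
  Induced (_∷_ {u} _ p) = Induced p × u ∉ᵥ p × NoChordFrom u p

  suffix : ∀ {a b x} (p : Walk R a b) → x ∈ᵥ p →
           Σ (Walk R x b) λ s → len s ≤ len p × (Induced p → Induced s)
  suffix [] refl = [] , z≤n , λ ind → ind
  suffix (e ∷ p) (inj₁ refl) = e ∷ p , ≤-refl , λ ind → ind
  suffix (e ∷ p) (inj₂ x∈p) with suffix p x∈p
  ... | s , s≤p , ind⇒ind = s , m≤n⇒m≤1+n s≤p , λ ind → ind⇒ind (proj₁ ind)

  shortest⇒induced : ∀ {a b} (p : Walk R a b) → Shortest p → Induced p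
  shortest⇒induced [] _ = tt
  shortest⇒induced (_∷_ {u} {_} {b} e p) shortest =
    shortest⇒induced p (λ q → ≤-pred (shortest (e ∷ q))) , no-return , no-chord p shortest
    where
    no-return : u ∉ᵥ p
    no-return u∈p with suffix p u∈p
    ... | s , s≤p , _ = 1+n≰n (≤-trans (shortest s) s≤p)
    no-chord : ∀ {w} (p : Walk R w b) → (∀ (q : Walk R u b) → suc (len p) ≤ len q) → NoChordFrom u p
    no-chord [] _ = tt
    no-chord (f ∷ p) shortest x x∈p ux with suffix p x∈p
    ... | s , s≤p , _ = 1+n≰n (≤-trans (≤-pred (shortest (ux ∷ s))) s≤p)

  head-neighbour : ∀ {a c b z} (e : R a c) (p : Walk R c b) → Induced (e ∷ p) → z ∈ᵥ p → R a z → z ≡ c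
  head-neighbour e [] _ refl _ = refl
  head-neighbour e (f ∷ p) _ (inj₁ refl) _ = refl
  head-neighbour e (f ∷ p) (_ , _ , no-chord) (inj₂ z∈p) az = ⊥-elim (no-chord _ z∈p az)

  vertexAt : ∀ {a b} → Walk R a b → ℕ → Fin n
  vertexAt {a} [] i = a
  vertexAt {a} (e ∷ p) zero = a
  vertexAt (e ∷ p) (suc i) = vertexAt p i

  vertexAt-zero : ∀ {a b} (p : Walk R a b) → vertexAt p 0 ≡ a
  vertexAt-zero [] = refl
  vertexAt-zero (e ∷ p) = refl

  vertexAt-len : ∀ {a b} (p : Walk R a b) → vertexAt p (len p) ≡ b
  vertexAt-len [] = refl
  vertexAt-len (e ∷ p) = vertexAt-len p

  vertexAt-∈ᵥ : ∀ {a b} (p : Walk R a b) i → vertexAt p i ∈ᵥ p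
  vertexAt-∈ᵥ [] i = refl
  vertexAt-∈ᵥ (e ∷ p) zero = inj₁ refl
  vertexAt-∈ᵥ (e ∷ p) (suc i) = inj₂ (vertexAt-∈ᵥ p i)

  vertexAt-edge : ∀ {a b} (p : Walk R a b) i → i < len p → R (vertexAt p i) (vertexAt p (suc i))
  vertexAt-edge (e ∷ p) zero _ = subst (R _) (sym (vertexAt-zero p)) e
  vertexAt-edge (e ∷ p) (suc i) (s≤s i<p) = vertexAt-edge p i i<p

  induced-vertexAt-distinct : ∀ {a b} (p : Walk R a b) → Induced p →
                              ∀ {i j} → i < j → j ≤ len p → vertexAt p i ≢ vertexAt p j
  induced-vertexAt-distinct (e ∷ p) ind {zero} {suc j} _ _ eq =
    proj₁ (proj₂ ind) (subst (_∈ᵥ p) (sym eq) (vertexAt-∈ᵥ p j))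
  induced-vertexAt-distinct (e ∷ p) ind {suc i} {suc j} (s≤s i<j) (s≤s j≤p) =
    induced-vertexAt-distinct p (proj₁ ind) i<j j≤p

  induced-vertexAt-injective : ∀ {a b} (p : Walk R a b) → Induced p →
                               ∀ {i j} → i ≤ len p → j ≤ len p → vertexAt p i ≡ vertexAt p j → i ≡ j
  induced-vertexAt-injective p ind {i} {j} i≤p j≤p eq with <-cmp i j
  ... | tri< i<j _ _ = ⊥-elim (induced-vertexAt-distinct p ind i<j j≤p eq)
  ... | tri≈ _ i≡j _ = i≡j
  ... | tri> _ _ j<i = ⊥-elim (induced-vertexAt-distinct p ind j<i i≤p (sym eq))

  induced-vertexAt-nonadjacent : ∀ {a b} (p : Walk R a b) → Induced p →
                                 ∀ {i j} → suc i < j → j ≤ len p → ¬ R (vertexAt p i) (vertexAt p j)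
  induced-vertexAt-nonadjacent (e ∷ p) ind {zero} {suc zero} (s≤s ()) _
  induced-vertexAt-nonadjacent (e ∷ []) ind {zero} {suc (suc j)} _ (s≤s ())
  induced-vertexAt-nonadjacent (e ∷ (f ∷ p)) ind {zero} {suc (suc j)} _ _ =
    proj₂ (proj₂ ind) (vertexAt p j) (vertexAt-∈ᵥ p j)
  induced-vertexAt-nonadjacent (e ∷ p) ind {suc i} {suc j} (s≤s i+1<j) (s≤s j≤p) =
    induced-vertexAt-nonadjacent p (proj₁ ind) i+1<j j≤p

  module _ (R? : Decidable R) where

    -- u is joined to the last of its neighbours on p, so the new path is again induced.
    prepend-induced : ∀ {a b} u (p : Walk R a b) → u ∉ᵥ p → Induced p →
                      Σ (Walk R u b) Induced ⊎ (∀ x → x ∈ᵥ p → ¬ R u x)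
    prepend-induced {a} u [] u∉p _ with R? u a
    ... | yes ua = inj₁ (ua ∷ [] , tt , u∉p , tt)
    ... | no ¬ua = inj₂ λ { x refl → ¬ua }
    prepend-induced {a} u (f ∷ p) u∉fp ind with prepend-induced u p (λ u∈p → u∉fp (inj₂ u∈p)) (proj₁ ind)
    ... | inj₁ q = inj₁ q
    ... | inj₂ u≁p with R? u a
    ...   | yes ua = inj₁ (ua ∷ (f ∷ p) , ind , u∉fp , u≁p)
    ...   | no ¬ua = inj₂ λ { x (inj₁ refl) → ¬ua ; x (inj₂ x∈p) → u≁p x x∈p }

    induce : ∀ {a b} → Walk R a b → Σ (Walk R a b) Induced
    induce [] = [] , tt
    induce (_∷_ {u} e p) with induce p
    ... | q , ind with u ∈ᵥ? q
    ...   | yes u∈q = proj₁ (suffix q u∈q) , proj₂ (proj₂ (suffix q u∈q)) ind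
    ...   | no u∉q with prepend-induced u q u∉q ind
    ...     | inj₁ r = r
    ...     | inj₂ u≁q = ⊥-elim (u≁q _ (start∈ᵥ q) e)

  avoiding-edge : ∀ {x y a b} (p : Walk R a b) → ¬ OnWalk x y p → Walk (DeleteEdge R x y) a b
  avoiding-edge [] _ = []
  avoiding-edge (e ∷ p) ¬on =
    (e , λ s → ¬on (here e p (sameEdge-sym s))) ∷ avoiding-edge p (λ on → ¬on (there e p on))

  avoiding-vertex : ∀ {x y z a b} (p : Walk R a b) → z ∉ᵥ p → z ≡ x ⊎ z ≡ y → Walk (DeleteEdge R x y) a b
  avoiding-vertex [] _ _ = []
  avoiding-vertex (_∷_ {u} e p) z∉ z∈xy =
    (e , λ s → z∉uv (sameEdge-endpoint s z∈xy)) ∷ avoiding-vertex p (λ z∈p → z∉ (inj₂ z∈p)) z∈xy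
    where
    z∉uv : ¬ (_ ≡ u ⊎ _ ≡ _)
    z∉uv (inj₁ z≡u) = z∉ (inj₁ z≡u)
    z∉uv (inj₂ refl) = z∉ (inj₂ (start∈ᵥ p))

  first-edge-not-on-tail : ∀ {a c b x y} (e : R a c) (p : Walk R c b) → Induced (e ∷ p) → OnWalk x y p →
                           ¬ SameEdge a c x y
  first-edge-not-on-tail e p (_ , a∉p , _) on (inj₁ (refl , _)) = a∉p (proj₁ (onWalk⇒∈ᵥ on))
  first-edge-not-on-tail e p (_ , a∉p , _) on (inj₂ (refl , _)) = a∉p (proj₂ (onWalk⇒∈ᵥ on))

  split-at-edge : ∀ {x y S T} (p : Walk R S T) → Induced p → OnWalk x y p →
                  (Walk (DeleteEdge R x y) S x × Walk (DeleteEdge R x y) y T)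
                  ⊎ (Walk (DeleteEdge R x y) S y × Walk (DeleteEdge R x y) x T)
  split-at-edge (e ∷ p) (_ , a∉p , _) (here _ _ (inj₁ (refl , refl))) = inj₁ ([] , avoiding-vertex p a∉p (inj₁ refl))
  split-at-edge (e ∷ p) (_ , a∉p , _) (here _ _ (inj₂ (refl , refl))) = inj₂ ([] , avoiding-vertex p a∉p (inj₂ refl))
  split-at-edge (e ∷ p) ind (there _ _ on) with split-at-edge p (proj₁ ind) on
  ... | inj₁ (Sx , yT) = inj₁ ((e , first-edge-not-on-tail e p ind on) ∷ Sx , yT)
  ... | inj₂ (Sy , xT) = inj₂ ((e , first-edge-not-on-tail e p ind on) ∷ Sy , xT)

  nonSeparating⇒¬separatedByBridge : ∀ {S T} → Σ (Walk R S T) NonSeparating → ¬ SeparatedByBridge R S T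
  nonSeparating⇒¬separatedByBridge (p , connected) (x , y , (_ , disconnected) , no-walk) with onWalk? x y p
  ... | yes on = disconnected λ c d →
    Walk-map (λ (e , ¬on) → e , λ s → ¬on (onWalk-sameEdge s on)) (connected c d)
  ... | no ¬on = no-walk (avoiding-edge p ¬on)

toℕ-csuc : ∀ {k} (i : Fin (suc k)) → toℕ i < k → toℕ (csuc i) ≡ suc (toℕ i)
toℕ-csuc i i<k = trans (toℕ-fromℕ< _) (m<n⇒m%n≡m (s≤s i<k))

toℕ-csuc-last : ∀ {k} (i : Fin (suc k)) → toℕ i ≡ k → toℕ (csuc i) ≡ 0
toℕ-csuc-last {k} i i≡k = trans (toℕ-fromℕ< _) (trans (cong (λ m → suc m % suc k) i≡k) (n%n≡0 (suc k)))

module _ {n : ℕ} {E : Rel (Fin n) 0ℓ} (G : SimpleGraph E) where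
  open SimpleGraph G renaming (sym to E-sym; irrefl to E-irrefl; dec to E?)

  onWalk⇒≢ : ∀ {x y a b} {p : Walk E a b} → OnWalk x y p → x ≢ y
  onWalk⇒≢ on x≡y = E-irrefl x≡y (onWalk⇒edge E-sym on)

  first-edge-common-neighbour-∉ᵥ : ∀ {a c b w} (e : E a c) (p : Walk E c b) → Induced (e ∷ p) →
                                   E a w → E w c → w ∉ᵥ (e ∷ p)
  first-edge-common-neighbour-∉ᵥ e p ind aw wc (inj₁ refl) = E-irrefl refl aw
  first-edge-common-neighbour-∉ᵥ e p ind aw wc (inj₂ w∈p) = E-irrefl (head-neighbour e p ind w∈p aw) wc

  common-neighbour-∉ᵥ : ∀ {a b u v w} (p : Walk E a b) → Induced p → OnWalk u v p → E u w → E w v → w ∉ᵥ p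
  common-neighbour-∉ᵥ (e ∷ p) ind (here _ _ (inj₁ (refl , refl))) uw wv =
    first-edge-common-neighbour-∉ᵥ e p ind uw wv
  common-neighbour-∉ᵥ (e ∷ p) ind (here _ _ (inj₂ (refl , refl))) uw wv =
    first-edge-common-neighbour-∉ᵥ e p ind (E-sym wv) (E-sym uw)
  common-neighbour-∉ᵥ (e ∷ p) ind (there _ _ on) uw wv (inj₁ refl) =
    onWalk⇒≢ on (trans (head-neighbour e p ind (proj₁ (onWalk⇒∈ᵥ on)) (E-sym uw))
                       (sym (head-neighbour e p ind (proj₂ (onWalk⇒∈ᵥ on)) wv)))
  common-neighbour-∉ᵥ (e ∷ p) ind (there _ _ on) uw wv (inj₂ w∈p) =
    common-neighbour-∉ᵥ p (proj₁ ind) on uw wv w∈p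

  induced-triangulated⇒nonSeparating :
    Connected E → ∀ {S T} (p : Walk E S T) → Induced p →
    (∀ {x y} → OnWalk x y p → ∃[ w ] (E x w × E w y)) → NonSeparating p
  induced-triangulated⇒nonSeparating connected p ind triangle x y = reroute (connected x y)
    where
    reroute : ∀ {a b} → Walk E a b → Walk (DeletePath p) a b
    reroute [] = []
    reroute (_∷_ {c} {d} e q) with onWalk? c d p
    ... | no ¬on = (e , ¬on) ∷ reroute q
    ... | yes on with triangle on
    ...   | w , cw , wd = (cw , λ on′ → w∉p (proj₂ (onWalk⇒∈ᵥ on′)))
                        ∷ ((wd , λ on′ → w∉p (proj₁ (onWalk⇒∈ᵥ on′))) ∷ reroute q)
      where
      w∉p : w ∉ᵥ p
      w∉p = common-neighbour-∉ᵥ p ind on cw wd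

  module ClosedPath {u v} (uv : E u v) (q : Walk (DeleteEdge E u v) u v) (ind : Induced q) where

    cycle : Fin (suc (len q)) → Fin n
    cycle i = vertexAt q (toℕ i)

    bound : ∀ (i : Fin (suc (len q))) → toℕ i ≤ len q
    bound i = ≤-pred (toℕ<n i)

    start-index : ∀ {i} → cycle i ≡ u → toℕ i ≡ 0
    start-index {i} iu = induced-vertexAt-injective q ind (bound i) z≤n (trans iu (sym (vertexAt-zero q)))

    end-index : ∀ {i} → cycle i ≡ v → toℕ i ≡ len q
    end-index {i} iv = induced-vertexAt-injective q ind (bound i) ≤-refl (trans iv (sym (vertexAt-len q)))

    cycle-injective : Injective _≡_ _≡_ cycle
    cycle-injective {i} {j} eq = toℕ-injective (induced-vertexAt-injective q ind (bound i) (bound j) eq)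

    cycle-edge : ∀ i → E (cycle i) (cycle (csuc i))
    cycle-edge i with m≤n⇒m<n∨m≡n (bound i)
    ... | inj₁ i<q = subst (λ k → E (cycle i) (vertexAt q k)) (sym (toℕ-csuc i i<q))
                           (proj₁ (vertexAt-edge q (toℕ i) i<q))
    ... | inj₂ i≡q = subst₂ E (sym (trans (cong (vertexAt q) i≡q) (vertexAt-len q)))
                              (trans (sym (vertexAt-zero q)) (cong (vertexAt q) (sym (toℕ-csuc-last i i≡q))))
                              (E-sym uv)

    chordless-forward : ∀ {i j} → toℕ i < toℕ j → E (cycle i) (cycle j) → j ≢ csuc i → i ≢ csuc j → ⊥
    chordless-forward {i} {j} i<j ij j≢i⁺ i≢j⁺ with m≤n⇒m<n∨m≡n i<j
    ... | inj₂ i⁺≡j = j≢i⁺ (toℕ-injective (trans (sym i⁺≡j) (sym (toℕ-csuc i i<q))))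
      where
      i<q : toℕ i < len q
      i<q = subst (_≤ len q) (sym i⁺≡j) (bound j)
    ... | inj₁ i⁺<j = induced-vertexAt-nonadjacent q ind i⁺<j (bound j) (ij , ij≠uv)
      where
      ij≠uv : ¬ SameEdge (cycle i) (cycle j) u v
      ij≠uv (inj₁ (iu , jv)) = i≢j⁺ (toℕ-injective (trans (start-index iu) (sym (toℕ-csuc-last j (end-index jv)))))
      ij≠uv (inj₂ (_ , ju)) with subst (suc (toℕ i) ≤_) (start-index ju) i<j
      ... | ()

    cycle-chordless : ¬ (∃[ i ] ∃[ j ] (E (cycle i) (cycle j) × j ≢ csuc i × i ≢ csuc j))
    cycle-chordless (i , j , ij , j≢i⁺ , i≢j⁺) with <-cmp (toℕ i) (toℕ j)
    ... | tri< i<j _ _ = chordless-forward i<j ij j≢i⁺ i≢j⁺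
    ... | tri≈ _ i≡j _ = E-irrefl (cong cycle (toℕ-injective i≡j)) ij
    ... | tri> _ _ j<i = chordless-forward j<i (E-sym ij) i≢j⁺ j≢i⁺

  long-bypass-not-induced : Chordal E → ∀ {u v a b c} (uv : E u v)
                            (r₁ : DeleteEdge E u v u a) (r₂ : DeleteEdge E u v a b) (r₃ : DeleteEdge E u v b c)
                            (q : Walk (DeleteEdge E u v) c v) → ¬ Induced (r₁ ∷ (r₂ ∷ (r₃ ∷ q)))
  long-bypass-not-induced chordal uv r₁ r₂ r₃ q ind =
    cycle-chordless (chordal (len q) cycle cycle-injective cycle-edge)
    where open ClosedPath uv (r₁ ∷ (r₂ ∷ (r₃ ∷ q))) ind

  chordal-edge-in-triangle : Chordal E → ∀ {u v} → E u v → Walk (DeleteEdge E u v) u v → ∃[ w ] (E u w × E w v)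
  chordal-edge-in-triangle chordal uv q with induce (DeleteEdge-dec E?) q
  ... | [] , _ = ⊥-elim (E-irrefl refl uv)
  ... | r ∷ [] , _ = ⊥-elim (proj₂ r (inj₁ (refl , refl)))
  ... | _∷_ {v = w} r (r′ ∷ []) , _ = w , proj₁ r , proj₁ r′
  ... | r₁ ∷ (r₂ ∷ (r₃ ∷ q′)) , ind = ⊥-elim (long-bypass-not-induced chordal uv r₁ r₂ r₃ q′ ind)

  unseparated-edge-in-triangle : Chordal E → ∀ {S T} → ¬ SeparatedByBridge E S T →
                                 (p : Walk E S T) → Induced p → ∀ {x y} → OnWalk x y p → ∃[ w ] (E x w × E w y)
  unseparated-edge-in-triangle chordal {S} {T} unseparated p ind {x} {y} on with any? (λ w → E? x w ×-dec E? w y)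
  ... | yes triangle = triangle
  ... | no ¬triangle =
    ⊥-elim (unseparated (x , y , (xy , λ connected → no-bypass (connected x y)) , λ ST → no-bypass (bypass ST)))
    where
    xy : E x y
    xy = onWalk⇒edge E-sym on
    no-bypass : ¬ Walk (DeleteEdge E x y) x y
    no-bypass r = ¬triangle (chordal-edge-in-triangle chordal xy r)
    rev : ∀ {a b} → Walk (DeleteEdge E x y) a b → Walk (DeleteEdge E x y) b a
    rev = reverse (DeleteEdge-sym E-sym)
    bypass : Walk (DeleteEdge E x y) S T → Walk (DeleteEdge E x y) x y
    bypass ST with split-at-edge p ind on
    ... | inj₁ (Sx , yT) = rev Sx ++ (ST ++ rev yT)
    ... | inj₂ (Sy , xT) = rev (rev Sy ++ (ST ++ rev xT))

theorem2 : (n : ℕ) (E : Rel (Fin n) 0ℓ) → SimpleGraph E → Connected E → Chordal E →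
           (S T : Fin n) → S ≢ T →
           ((Σ (Walk E S T) NonSeparating) ⇔ (¬ SeparatedByBridge E S T))
           × ((Σ (Walk E S T) NonSeparating) → (p : Walk E S T) → Shortest p → NonSeparating p)
theorem2 n E G connected chordal S T _ =
  mk⇔ nonSeparating⇒¬separatedByBridge unseparated⇒nonSeparating , shortest-nonSeparating
  where
  nonSeparating-if-induced : ¬ SeparatedByBridge E S T → (p : Walk E S T) → Induced p → NonSeparating p
  nonSeparating-if-induced unseparated p ind =
    induced-triangulated⇒nonSeparating G connected p ind (unseparated-edge-in-triangle G chordal unseparated p ind)

  unseparated⇒nonSeparating : ¬ SeparatedByBridge E S T → Σ (Walk E S T) NonSeparating
  unseparated⇒nonSeparating unseparated with induce (SimpleGraph.dec G) (connected S T)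
  ... | p , ind = p , nonSeparating-if-induced unseparated p ind

  shortest-nonSeparating : Σ (Walk E S T) NonSeparating → (p : Walk E S T) → Shortest p → NonSeparating p
  shortest-nonSeparating nonSep p shortest =
    nonSeparating-if-induced (nonSeparating⇒¬separatedByBridge nonSep) p (shortest⇒induced p shortest)
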